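{- Let $r\geq2$. Set $\mathcal{D}_{r',i}:=\mathcal{D}_{r',r'}$ whenever $i>r'$, and $\mathcal{D}_{1,1}:=\{\emptyset\}$ (the set containing only the empty partition). Then: (1) $\mathcal{D}_{r,1}\setminus\mathcal{D}_{r-1,1}$ is the set of partitions $\lambda$ with exactly $r-1$ horizontal Durfee rectangles of heights $>0$ and nothing after the last one, i.e. in the $(r-1)$-Durfee dissection $c_1,\dots,c_{r-1}\ge1$ and $c_1+\dots+c_{r-1}$ equals the number of parts of $\lambda$. (2) $\mathcal{D}_{r,r}\setminus\mathcal{D}_{r-1,r}=\mathcal{D}_{r,r}\setminus\mathcal{D}_{r-1,r-1}$ is the set of partitions with exactly $r-1$ non-empty Durfee squares, i.e. in the $0$-Durfee dissection $c_1,\dots,c_{r-1}\ge1$ and their sum equals the number of parts. (3) If $2\leq i\leq r-1$, then $\mathcal{D}_{r,i}\setminus\mathcal{D}_{r-1,i}$ is the set of partitions $\lambda$ which, in their $(r-i)$-Durfee dissection, have exactly $r-i$ Durfee rectangles of heights $d'_1,\dots,d'_{r-i}>0$ followed by exactly $i-1$ non-empty Durfee squares of sides $d_{r-i+1},\dots,d_{r-1}\ge1$ covering all rows, and which satisfy one of the following: (a) $S_\lambda=\emptyset$ and $d_{r-1}>1$; (b) $S_\lambda\neq\emptyset$ and $m_\lambda=1$; (c) $S_\lambda\neq\emptyset$, $2\leq m_\lambda\leq i-1$ and $d_{r-i+m_\lambda-1}>1$.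
   Context: A partition $\lambda=(\lambda_1,\dots,\lambda_s)$ is a non-increasing finite sequence of positive integers. For a (possibly empty) partition $\mu=(\mu_1,\dots,\mu_t)$ let $\mathrm{sq}(\mu)=\max\{d\ge0:d\le t,\ \mu_d\ge d\}$ and $\mathrm{rect}(\mu)=\max\{h\ge0:h\le t,\ \mu_h\ge h+1\}$. For $k\ge0$ the $k$-Durfee dissection of $\lambda$: $\mu^{(0)}=\lambda$, $c_j=\mathrm{rect}(\mu^{(j-1)})$ if $j\le k$ (height of the $j$-th horizontal Durfee rectangle, which has $c_j$ rows and $c_j+1$ columns), $c_j=\mathrm{sq}(\mu^{(j-1)})$ if $j>k$ (side of a Durfee square), and $\mu^{(j)}$ is $\mu^{(j-1)}$ with its first $c_j$ parts deleted. For $r\ge2$, $1\le i\le r$, $\mathcal{D}_{r,i}$ is the set of partitions for which, in the $(r-i)$-Durfee dissection, $\mu^{(r-1)}$ is empty. For $\lambda$ as in (3), with $d'_j=c_j$ ($j\le r-i$) and $d_{r-i+j}=c_{r-i+j}$ ($1\le j\le i-1$): $S_\lambda$ is the set of $j\in\{1,\dots,i-1\}$ such that $\lambda_{R_j}<d_{r-i+j-1}$ when $j\ge2$, and $\lambda_{R_1}<d'_{r-i}+1$ when $j=1$, where $R_j=d'_1+\dots+d'_{r-i}+d_{r-i+1}+\dots+d_{r-i+j-1}+1$ is the first row of the $j$-th Durfee square. If $S_\lambda\ne\emptyset$, $m_\lambda=\min S_\lambda$. -}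

module Defs where

open import Data.Nat using (ℕ; zero; suc; _+_; _∸_; _≤_; _<_; _⊓_; _≤ᵇ_)
open import Data.Bool using (Bool; if_then_else_)
open import Data.List using (List; []; _∷_; drop; take; length)
open import Data.Nat.ListAction using (sum)
open import Data.Sum using (_⊎_)
open import Data.Empty using (⊥)
open import Data.List.Relation.Unary.All using (All)
open import Data.List.Relation.Unary.Linked using (Linked)
open import Data.Product using (_×_; _,_; proj₁; proj₂; ∃-syntax)
open import Relation.Binary.PropositionalEquality using (_≡_)
open import Relation.Nullary using (¬_)

IsPartition : List ℕ → Set
IsPartition μ = All (λ x → 1 ≤ x) μ × Linked (λ a b → b ≤ a) μ

-- 1-based lookup μ_j (default 0 when out of range / j = 0).
nth : List ℕ → ℕ → ℕ
nth []       _             = 0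
nth (x ∷ xs) zero          = 0
nth (x ∷ xs) (suc zero)    = x
nth (x ∷ xs) (suc (suc n)) = nth xs (suc n)

-- maxIdx P n μ : largest index d (indices of μ numbered from n on) with P d μ_d,
-- or 0 if there is none.
maxIdx : (ℕ → ℕ → Bool) → ℕ → List ℕ → ℕ
maxIdx P n []       = 0
maxIdx P n (x ∷ xs) with maxIdx P (suc n) xs
... | zero  = if P n x then n else 0
... | suc m = suc m

sq : List ℕ → ℕ
sq = maxIdx (λ d x → d ≤ᵇ x) 1

rect : List ℕ → ℕ
rect = maxIdx (λ h x → suc h ≤ᵇ x) 1

-- dissect k n μ = ([c_1,…,c_n], μ^{(n)}) for the k-Durfee dissection:
-- the first k steps use rect, later steps use sq.
dissect : ℕ → ℕ → List ℕ → List ℕ × List ℕ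
dissect k       zero    μ = [] , μ
dissect zero    (suc n) μ with dissect zero n (drop (sq μ) μ)
... | cs , rest = sq μ ∷ cs , rest
dissect (suc k) (suc n) μ with dissect k n (drop (rect μ) μ)
... | cs , rest = rect μ ∷ cs , rest

cs : ℕ → ℕ → List ℕ → List ℕ
cs k n μ = proj₁ (dissect k n μ)

-- D_{r,i} for 1 ≤ i ≤ r: μ^{(r-1)} = ∅ in the (r-i)-Durfee dissection.
InD₀ : ℕ → ℕ → List ℕ → Set
InD₀ r i λ' = proj₂ (dissect (r ∸ i) (r ∸ 1) λ') ≡ []

-- With the conventions D_{r,i} := D_{r,r} for i > r (via i ⊓ r), and
-- D_{1,1} = {∅} (which is exactly what InD₀ 1 1 gives: λ = []).
InD : ℕ → ℕ → List ℕ → Set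
InD r i λ' = InD₀ r (i ⊓ r) λ'

Covers : List ℕ → List ℕ → Set
Covers c λ' = All (λ x → 1 ≤ x) c × sum c ≡ length λ'

-- Notation of (3): c = [d'_1,…,d'_{r-i}, d_{r-i+1},…,d_{r-1}] (c_j = nth c j).
-- R_j = c_1 + … + c_{r-i+j-1} + 1
Row : ℕ → ℕ → List ℕ → ℕ → ℕ
Row r i c j = sum (take (r ∸ i + j ∸ 1) c) + 1

InS : ℕ → ℕ → List ℕ → ℕ → Set
InS r i λ' zero          = ⊥
InS r i λ' (suc zero)    = nth λ' (Row r i (cs (r ∸ i) (r ∸ 1) λ') 1) < nth (cs (r ∸ i) (r ∸ 1) λ') (r ∸ i) + 1
InS r i λ' (suc (suc j)) = nth λ' (Row r i (cs (r ∸ i) (r ∸ 1) λ') (suc (suc j)))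
                             < nth (cs (r ∸ i) (r ∸ 1) λ') (r ∸ i + suc (suc j) ∸ 1)

SEmpty : ℕ → ℕ → List ℕ → Set
SEmpty r i λ' = ∀ j → 1 ≤ j → j ≤ i ∸ 1 → ¬ InS r i λ' j

IsMinS : ℕ → ℕ → List ℕ → ℕ → Set
IsMinS r i λ' m = (1 ≤ m × m ≤ i ∸ 1 × InS r i λ' m)
                × (∀ j → 1 ≤ j → j < m → ¬ InS r i λ' j)

Cond3 : ℕ → ℕ → List ℕ → Set
Cond3 r i λ' =
  Covers c λ' ×
  ( (SEmpty r i λ' × 1 < nth c (r ∸ 1))
  ⊎ (IsMinS r i λ' 1)
  ⊎ (∃[ m ] (IsMinS r i λ' m × 2 ≤ m × m ≤ i ∸ 1 × 1 < nth c (r ∸ i + m ∸ 1))) )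
  where
  c = cs (r ∸ i) (r ∸ 1) λ'

-- Parts (1) and (2) involve one kind of block only: an empty block leaves the remainder
-- unchanged, so the dissection stalls, and "exhausted after r − 1 blocks but not after r − 2"
-- means exactly that r − 1 non-empty blocks cover all rows.
-- For part (3) the dissections with r − i and with r − i − 1 rectangles share their first
-- r − i − 1 blocks. Then the first one takes a rectangle of height h, while the second takes a
-- square of side h or h + 1, according as the row below the rectangle is shorter than h + 1 or not.
-- From there on the second dissection is either level with the first or one row ahead of it, and
-- it catches up exactly after a block whose next row is shorter than the block's width, the least
-- element of S_λ. So, when the first dissection exhausts λ, the second one does not iff it catches
-- up after a block of width > 1 (cases (b), (c)), or never catches up and the last square has
-- side > 1 (case (a)).
module Submission where

open import Data.Bool using (true; false; T)
open import Data.Bool.Properties using (T-≡)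
open import Data.Empty using (⊥)
open import Data.List using (List; []; _∷_; drop; take; length)
open import Data.List.Properties using (length-drop; drop-drop; drop-all)
open import Data.List.Relation.Unary.All using (All; []; _∷_)
open import Data.List.Relation.Unary.Linked as Linked using (Linked; []; [-]; _∷_)
open import Data.Nat
open import Data.Nat.ListAction using (sum)
open import Data.Nat.Properties
open import Data.Product using (_×_; _,_; proj₁; proj₂; ∃-syntax)
open import Data.Product.Function.NonDependent.Propositional using (_×-⇔_)
open import Data.Sum using (_⊎_; inj₁; inj₂; map₂)
open import Data.Sum.Function.Propositional using (_⊎-⇔_)
open import Function using (_∘_; id)
open import Function.Bundles using (_⇔_; mk⇔; Equivalence)
import Function.Properties.Equivalence as ⇔
open import Relation.Binary.PropositionalEquality
open import Relation.Nullary using (¬_; yes; no; contradiction)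

open import Defs

open Equivalence using (to; from)

NonIncreasing : List ℕ → Set
NonIncreasing = Linked (λ a b → b ≤ a)

NonIncreasing-tail : ∀ {ρ} → NonIncreasing ρ → NonIncreasing (drop 1 ρ)
NonIncreasing-tail []        = []
NonIncreasing-tail [-]       = []
NonIncreasing-tail (_ ∷ mon) = mon

IsPartition-drop : ∀ k {μ} → IsPartition μ → IsPartition (drop k μ)
IsPartition-drop zero    p                       = p
IsPartition-drop (suc k) {[]}    p               = p
IsPartition-drop (suc k) {x ∷ μ} (_ ∷ pos , mon) = IsPartition-drop k (pos , Linked.tail mon)

drop-suc : ∀ k (ρ : List ℕ) → drop (suc k) ρ ≡ drop 1 (drop k ρ)
drop-suc zero    ρ       = refl
drop-suc (suc k) []      = refl
drop-suc (suc k) (x ∷ ρ) = drop-suc k ρ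

drop≡[]⇒length≤ : ∀ k (ρ : List ℕ) → drop k ρ ≡ [] → length ρ ≤ k
drop≡[]⇒length≤ k ρ done = m∸n≡0⇒m≤n (trans (sym (length-drop k ρ)) (cong length done))

nth-∷ : ∀ x xs m → 1 ≤ m → nth (x ∷ xs) (suc m) ≡ nth xs m
nth-∷ x xs (suc m) _ = refl

nth-tail : ∀ (ρ : List ℕ) j → nth (drop 1 ρ) (suc j) ≡ nth ρ (suc (suc j))
nth-tail []      j = refl
nth-tail (x ∷ ρ) j = refl

nth-drop-head : ∀ k ρ → nth (drop k ρ) 1 ≡ nth ρ (suc k)
nth-drop-head zero    ρ       = refl
nth-drop-head (suc k) []      = refl
nth-drop-head (suc k) (x ∷ ρ) = nth-drop-head k ρ

nth-drop : ∀ k ρ j → nth (drop k ρ) (j + 1) ≡ nth ρ (k + j + 1)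
nth-drop zero    ρ       j = refl
nth-drop (suc k) []      j = refl
nth-drop (suc k) (x ∷ ρ) j = trans (nth-drop k ρ j) (sym (nth-∷ x ρ (k + j + 1) (m≤n+m 1 (k + j))))

nth-beyond : ∀ xs j → length xs ≤ j → nth xs (suc j) ≡ 0
nth-beyond []           j       _         = refl
nth-beyond (x ∷ [])     (suc j) _         = refl
nth-beyond (x ∷ y ∷ xs) (suc j) (s≤s len) = nth-beyond (y ∷ xs) j len

nth-antitone : ∀ {ρ} → NonIncreasing ρ → ∀ {a b} → a ≤ b → nth ρ (suc b) ≤ nth ρ (suc a)
nth-antitone []          _                         = z≤n
nth-antitone [-]         {b = zero}  z≤n           = ≤-refl
nth-antitone [-]         {b = suc b} _             = z≤n
nth-antitone (y≤x ∷ mon) {zero}  {zero}  _         = ≤-refl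
nth-antitone (y≤x ∷ mon) {zero}  {suc b} _         = ≤-trans (nth-antitone mon (z≤n {b})) y≤x
nth-antitone (y≤x ∷ mon) {suc a} {suc b} (s≤s a≤b) = nth-antitone mon a≤b

1≤head : ∀ {ρ} → IsPartition ρ → ¬ ρ ≡ [] → 1 ≤ nth ρ 1
1≤head {[]}    _             ρ≢[] = contradiction refl ρ≢[]
1≤head {x ∷ ρ} (1≤x ∷ _ , _) _    = 1≤x

maxIdx-sound : ∀ P n xs → maxIdx P n xs ≡ 0 ⊎
  ∃[ j ] (maxIdx P n xs ≡ n + j × j < length xs × P (n + j) (nth xs (suc j)) ≡ true)
maxIdx-sound P n []       = inj₁ refl
maxIdx-sound P n (x ∷ xs) with maxIdx P (suc n) xs | maxIdx-sound P (suc n) xs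
... | suc _ | inj₂ (j , eq , j<len , Pj) =
  inj₂ (suc j , trans eq (sym (+-suc n j)) , s≤s j<len , trans (cong (λ k → P k (nth xs (suc j))) (+-suc n j)) Pj)
... | zero  | _ with P n x in Pn
...   | true  = inj₂ (0 , sym (+-identityʳ n) , s≤s z≤n , trans (cong (λ k → P k x) (+-identityʳ n)) Pn)
...   | false = inj₁ refl

maxIdx-maximal : ∀ P n xs j → j < length xs → maxIdx P n xs < n + j → P (n + j) (nth xs (suc j)) ≡ false
maxIdx-maximal P n (x ∷ xs) j j<len above
  with maxIdx P (suc n) xs | maxIdx-sound P (suc n) xs | maxIdx-maximal P (suc n) xs
maxIdx-maximal P n (x ∷ xs) zero _ above | zero | _ | _ with P n x in Pn
... | true  = contradiction (subst (n <_) (+-identityʳ n) above) (n≮n n)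
... | false = trans (cong (λ k → P k x) (+-identityʳ n)) Pn
maxIdx-maximal P n (x ∷ xs) (suc j) (s≤s j<len) _ | zero | _ | ih =
  trans (cong (λ k → P k (nth xs (suc j))) (+-suc n j)) (ih j j<len (s≤s z≤n))
maxIdx-maximal P n (x ∷ xs) zero _ above | suc m | inj₂ (j′ , eq , _) | _ =
  contradiction (subst (suc m <_) (+-identityʳ n) above) (<-asym (subst (n <_) (sym eq) (m≤m+n (suc n) j′)))
maxIdx-maximal P n (x ∷ xs) (suc j) (s≤s j<len) above | suc m | _ | ih =
  trans (cong (λ k → P k (nth xs (suc j))) (+-suc n j)) (ih j j<len (subst (suc m <_) (+-suc n j) above))

-- durfee 0 is sq and durfee 1 is rect, definitionally.
durfee : ℕ → List ℕ → ℕ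
durfee t = maxIdx (λ d x → t + d ≤ᵇ x) 1

Fits : ℕ → List ℕ → ℕ → Set
Fits t μ d = d ≡ 0 ⊎ t + d ≤ nth μ d

fits-suc : ∀ {t μ d} → Fits t μ (suc d) → t + suc d ≤ nth μ (suc d)
fits-suc (inj₂ fit) = fit

durfee-fits : ∀ t μ → Fits t μ (durfee t μ)
durfee-fits t μ with maxIdx-sound (λ d x → t + d ≤ᵇ x) 1 μ
... | inj₁ d≡0 = inj₁ d≡0
... | inj₂ (j , d≡ , _ , fits) rewrite d≡ = inj₂ (≤ᵇ⇒≤ _ _ (from T-≡ fits))

durfee-≤-length : ∀ t μ → durfee t μ ≤ length μ
durfee-≤-length t μ with maxIdx-sound (λ d x → t + d ≤ᵇ x) 1 μ
... | inj₁ d≡0 rewrite d≡0 = z≤n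
... | inj₂ (j , d≡ , j<len , _) rewrite d≡ = j<len

durfee-next : ∀ t μ → nth μ (suc (durfee t μ)) < t + suc (durfee t μ)
durfee-next t μ with length μ ≤? durfee t μ
... | yes beyond rewrite nth-beyond μ _ beyond = <-≤-trans z<s (m≤n+m _ t)
... | no  within = ≰⇒> λ fits → subst T unfit (≤⇒≤ᵇ fits)
  where unfit = maxIdx-maximal (λ d x → t + d ≤ᵇ x) 1 μ (durfee t μ) (≰⇒> within) ≤-refl

fits-≤ : ∀ {t μ d d′} → NonIncreasing μ → Fits t μ d → nth μ (suc d′) < t + suc d′ → d ≤ d′
fits-≤ {d = zero} _ _ _ = z≤n
fits-≤ {t} {μ} {suc d} {d′} mon (inj₂ fit) short with suc d ≤? d′
... | yes d<d′ = d<d′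
... | no  d≮d′ = contradiction fit (<⇒≱ (begin-strict
  nth μ (suc d)   ≤⟨ nth-antitone mon d′≤d ⟩
  nth μ (suc d′)  <⟨ short ⟩
  t + suc d′      ≤⟨ +-monoʳ-≤ t (s≤s d′≤d) ⟩
  t + suc d       ∎))
  where
  open ≤-Reasoning
  d′≤d = s≤s⁻¹ (≰⇒> d≮d′)

durfee-unique : ∀ {t μ d} → NonIncreasing μ → Fits t μ d → nth μ (suc d) < t + suc d → durfee t μ ≡ d
durfee-unique {t} {μ} mon fit short =
  ≤-antisym (fits-≤ mon (durfee-fits t μ) short) (fits-≤ mon fit (durfee-next t μ))

sq-positive : ∀ {ρ} → IsPartition ρ → ¬ ρ ≡ [] → 1 ≤ sq ρ
sq-positive {ρ} p ρ≢[] = n≢0⇒n>0 λ sq≡0 →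
  <⇒≱ (subst (λ d → nth ρ (suc d) < suc d) sq≡0 (durfee-next 0 ρ)) (1≤head p ρ≢[])

module _ (step : List ℕ → ℕ) where

  peel : List ℕ → List ℕ
  peel μ = drop (step μ) μ

  blocks : ℕ → List ℕ → List ℕ
  blocks zero    μ = []
  blocks (suc n) μ = step μ ∷ blocks n (peel μ)

  leftover : ℕ → List ℕ → List ℕ
  leftover zero    μ = μ
  leftover (suc n) μ = leftover n (peel μ)

HeadBelow : ℕ → List ℕ → Set
HeadBelow w ρ = nth ρ 1 < w

sq-after-rect-shut : ∀ {ν} → NonIncreasing ν → HeadBelow (suc (rect ν)) (peel rect ν) → sq ν ≡ rect ν
sq-after-rect-shut {ν} mon shut = durfee-unique mon
  (map₂ (≤-trans (n≤1+n _)) (durfee-fits 1 ν))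
  (subst (_< suc (rect ν)) (nth-drop-head (rect ν) ν) shut)

sq-after-rect-open : ∀ {ν} → NonIncreasing ν → ¬ HeadBelow (suc (rect ν)) (peel rect ν) → sq ν ≡ suc (rect ν)
sq-after-rect-open {ν} mon unshut = durfee-unique {0} mon
  (inj₂ (subst (suc (rect ν) ≤_) (nth-drop-head (rect ν) ν) (≮⇒≥ unshut)))
  (≤-<-trans (nth-antitone mon (n≤1+n (rect ν))) (durfee-next 1 ν))

sq-tail-shut : ∀ {ρ e} → NonIncreasing ρ → sq ρ ≡ suc e → HeadBelow (suc e) (drop (suc e) ρ) →
  sq (drop 1 ρ) ≡ e
sq-tail-shut {ρ} {e} mon sq≡ shut = durfee-unique (NonIncreasing-tail mon) (fit e sq≡)
  (subst (_< suc e) (trans (nth-drop-head (suc e) ρ) (sym (nth-tail ρ e))) shut)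
  where
  fit : ∀ e → sq ρ ≡ suc e → Fits 0 (drop 1 ρ) e
  fit zero    _   = inj₁ refl
  fit (suc e) sq≡ = inj₂ (subst (suc e ≤_) (sym (nth-tail ρ e))
    (≤-trans (n≤1+n _) (fits-suc {0} {ρ} (subst (Fits 0 ρ) sq≡ (durfee-fits 0 ρ)))))

sq-tail-open : ∀ {ρ} → NonIncreasing ρ → ¬ HeadBelow (sq ρ) (peel sq ρ) → sq (drop 1 ρ) ≡ sq ρ
sq-tail-open {ρ} mon unshut = durfee-unique (NonIncreasing-tail mon) (fit (sq ρ) unshut)
  (subst (_< suc (sq ρ)) (sym (nth-tail ρ (sq ρ))) (≤-<-trans (nth-antitone mon (n≤1+n (sq ρ))) (durfee-next 0 ρ)))
  where
  fit : ∀ d → ¬ HeadBelow d (drop d ρ) → Fits 0 (drop 1 ρ) d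
  fit zero    _      = inj₁ refl
  fit (suc d) unshut = inj₂ (subst (suc d ≤_) (trans (nth-drop-head (suc d) ρ) (sym (nth-tail ρ d))) (≮⇒≥ unshut))

peel-after-rect-shut : ∀ {ν} → NonIncreasing ν → HeadBelow (suc (rect ν)) (peel rect ν) → peel sq ν ≡ peel rect ν
peel-after-rect-shut {ν} mon shut = cong (λ k → drop k ν) (sq-after-rect-shut mon shut)

peel-after-rect-open : ∀ {ν} → NonIncreasing ν → ¬ HeadBelow (suc (rect ν)) (peel rect ν) →
  peel sq ν ≡ drop 1 (peel rect ν)
peel-after-rect-open {ν} mon unshut =
  trans (cong (λ k → drop k ν) (sq-after-rect-open mon unshut)) (drop-suc (rect ν) ν)

peel-tail-shut : ∀ {ρ} → NonIncreasing ρ → 1 ≤ sq ρ → HeadBelow (sq ρ) (peel sq ρ) → peel sq (drop 1 ρ) ≡ peel sq ρ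
peel-tail-shut {ρ} mon pos shut with sq ρ in sq≡
... | suc e = trans (cong (λ k → drop k (drop 1 ρ)) (sq-tail-shut mon sq≡ shut)) (drop-drop 1 e ρ)

peel-tail-open : ∀ {ρ} → NonIncreasing ρ → ¬ HeadBelow (sq ρ) (peel sq ρ) → peel sq (drop 1 ρ) ≡ drop 1 (peel sq ρ)
peel-tail-open {ρ} mon unshut =
  trans (cong (λ k → drop k (drop 1 ρ)) (sq-tail-open mon unshut)) (trans (drop-drop 1 (sq ρ) ρ) (drop-suc (sq ρ) ρ))

Covers-[] : ∀ {μ : List ℕ} → Covers [] μ ⇔ μ ≡ []
Covers-[] = mk⇔ (λ (_ , 0≡len) → length≡0 _ 0≡len) (λ { refl → [] , refl })
  where
  length≡0 : ∀ (μ : List ℕ) → 0 ≡ length μ → μ ≡ []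
  length≡0 [] _ = refl

Covers-∷ : ∀ {e c μ} → e ≤ length μ → Covers (e ∷ c) μ ⇔ (1 ≤ e × Covers c (drop e μ))
Covers-∷ {e} {c} {μ} e≤len = mk⇔
  (λ { (pos ∷ poss , total) → pos , poss ,
         trans (sym (m+n∸m≡n e (sum c))) (trans (cong (_∸ e) total) (sym (length-drop e μ))) })
  (λ (pos , poss , total) → pos ∷ poss ,
     trans (cong (e +_) (trans total (length-drop e μ))) (m+[n∸m]≡n e≤len))

module _ (step : List ℕ → ℕ) (step≤length : ∀ μ → step μ ≤ length μ) where

  EndsAt : ℕ → List ℕ → Set
  EndsAt n μ = leftover step (suc n) μ ≡ [] × ¬ leftover step n μ ≡ []

  EndsAt⇒1≤step : ∀ n {μ} → EndsAt n μ → 1 ≤ step μ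
  EndsAt⇒1≤step n {μ} (done , ¬done) =
    n≢0⇒n>0 λ step≡0 → ¬done (subst (λ k → leftover step n (drop k μ) ≡ []) step≡0 done)

  exact-cover : ∀ n μ → EndsAt n μ ⇔ Covers (blocks step (suc n) μ) μ
  exact-cover zero μ = mk⇔
    (λ ends → from (Covers-∷ (step≤length μ)) (EndsAt⇒1≤step 0 ends , from Covers-[] (proj₁ ends)))
    (λ cover → let pos , rest = to (Covers-∷ (step≤length μ)) cover in
       to Covers-[] rest , λ { refl → contradiction (step≤length []) (<⇒≱ pos) })
  exact-cover (suc n) μ = mk⇔
    (λ ends → from (Covers-∷ (step≤length μ)) (EndsAt⇒1≤step (suc n) ends , to (exact-cover n (peel step μ)) ends))
    (λ cover → from (exact-cover n (peel step μ)) (proj₂ (to (Covers-∷ (step≤length μ)) cover)))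

rest : ℕ → ℕ → List ℕ → List ℕ
rest k n μ = proj₂ (dissect k n μ)

rest-[] : ∀ n → rest 0 n [] ≡ []
rest-[] zero    = refl
rest-[] (suc n) = rest-[] n

rest≢[]⇒≢[] : ∀ n {ρ} → ¬ rest 0 n ρ ≡ [] → ¬ ρ ≡ []
rest≢[]⇒≢[] n ¬done refl = ¬done (rest-[] n)

leftover-squares : ∀ n μ → leftover sq n μ ≡ rest 0 n μ
leftover-squares zero    μ = refl
leftover-squares (suc n) μ = leftover-squares n (peel sq μ)

blocks-squares : ∀ n μ → blocks sq n μ ≡ cs 0 n μ
blocks-squares zero    μ = refl
blocks-squares (suc n) μ = cong (sq μ ∷_) (blocks-squares n (peel sq μ))

leftover-rects : ∀ n μ → leftover rect n μ ≡ rest n n μ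
leftover-rects zero    μ = refl
leftover-rects (suc n) μ = leftover-rects n (peel rect μ)

blocks-rects : ∀ n μ → blocks rect n μ ≡ cs n n μ
blocks-rects zero    μ = refl
blocks-rects (suc n) μ = cong (rect μ ∷_) (blocks-rects n (peel rect μ))

exact-cover-squares : ∀ n μ → (rest 0 (suc n) μ ≡ [] × ¬ rest 0 n μ ≡ []) ⇔ Covers (cs 0 (suc n) μ) μ
exact-cover-squares n μ =
  subst₂ _⇔_ (cong₂ (λ a b → a ≡ [] × ¬ b ≡ []) (leftover-squares (suc n) μ) (leftover-squares n μ))
             (cong (λ c → Covers c μ) (blocks-squares (suc n) μ))
             (exact-cover sq (durfee-≤-length 0) n μ)

exact-cover-rects : ∀ n μ → (rest (suc n) (suc n) μ ≡ [] × ¬ rest n n μ ≡ []) ⇔ Covers (cs (suc n) (suc n) μ) μ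
exact-cover-rects n μ =
  subst₂ _⇔_ (cong₂ (λ a b → a ≡ [] × ¬ b ≡ []) (leftover-rects (suc n) μ) (leftover-rects n μ))
             (cong (λ c → Covers c μ) (blocks-rects (suc n) μ))
             (exact-cover rect (durfee-≤-length 1) n μ)

length-cs : ∀ k n μ → length (cs k n μ) ≡ n
length-cs k       zero    μ = refl
length-cs zero    (suc n) μ = cong suc (length-cs zero n (peel sq μ))
length-cs (suc k) (suc n) μ = cong suc (length-cs k n (peel rect μ))

-- Survives t ρ c: the square dissection of ρ shifted one row down (t = 0), or of ρ itself (t = 1),
-- is not exhausted after one block fewer than the blocks c of ρ, the first of width t + c₁.
Survives : ℕ → List ℕ → List ℕ → Set
Survives t ρ []           = ⊥
Survives t ρ (e ∷ [])     = 1 < t + e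
Survives t ρ (e ∷ e′ ∷ c) =
  (HeadBelow (t + e) (drop e ρ) × 1 < t + e) ⊎ (¬ HeadBelow (t + e) (drop e ρ) × Survives 0 (drop e ρ) (e′ ∷ c))

survives-squares : ∀ n ρ → IsPartition ρ →
  (rest 0 (suc n) ρ ≡ [] × ¬ rest 0 n (drop 1 ρ) ≡ []) ⇔ (Covers (cs 0 (suc n) ρ) ρ × Survives 0 ρ (cs 0 (suc n) ρ))
survives-squares zero ρ p = mk⇔
  (λ (done , ¬done₁) → to (exact-cover-squares 0 ρ) (done , λ { refl → ¬done₁ refl }) ,
     ≰⇒> λ e≤1 → ¬done₁ (drop-all 1 ρ (≤-trans (drop≡[]⇒length≤ (sq ρ) ρ done) e≤1)))
  (λ (cover , 1<e) → proj₁ (from (exact-cover-squares 0 ρ) cover) , λ done₁ →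
     contradiction (≤-trans 1<e (≤-trans (durfee-≤-length 0 ρ) (drop≡[]⇒length≤ 1 ρ done₁))) λ { (s≤s ()) })
survives-squares (suc n) ρ p = mk⇔ forward backward
  where
  ρ′ = peel sq ρ
  p′ = IsPartition-drop (sq ρ) p
  mon = proj₂ p
  cover-∷ = Covers-∷ {sq ρ} {cs 0 (suc n) ρ′} (durfee-≤-length 0 ρ)

  pos : ¬ rest 0 (suc n) (drop 1 ρ) ≡ [] → 1 ≤ sq ρ
  pos ¬done₁ = sq-positive p (rest≢[]⇒≢[] (suc n) ¬done₁ ∘ cong (drop 1))

  forward : rest 0 (suc n) ρ′ ≡ [] × ¬ rest 0 (suc n) (drop 1 ρ) ≡ [] →
            Covers (cs 0 (suc (suc n)) ρ) ρ × Survives 0 ρ (cs 0 (suc (suc n)) ρ)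
  forward (done , ¬done₁) with nth ρ′ 1 <? sq ρ
  ... | yes shut = from cover-∷ (pos ¬done₁ , to (exact-cover-squares n ρ′) (done , ¬done)) ,
                   inj₁ (shut , ≤-<-trans (1≤head p′ (rest≢[]⇒≢[] n ¬done)) shut)
    where ¬done = subst (λ μ → ¬ rest 0 n μ ≡ []) (peel-tail-shut mon (pos ¬done₁) shut) ¬done₁
  ... | no unshut = from cover-∷ (pos ¬done₁ , proj₁ survives) , inj₂ (unshut , proj₂ survives)
    where
    survives = to (survives-squares n ρ′ p′)
      (done , subst (λ μ → ¬ rest 0 n μ ≡ []) (peel-tail-open mon unshut) ¬done₁)

  backward : Covers (cs 0 (suc (suc n)) ρ) ρ × Survives 0 ρ (cs 0 (suc (suc n)) ρ) →
             rest 0 (suc n) ρ′ ≡ [] × ¬ rest 0 (suc n) (drop 1 ρ) ≡ []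
  backward (cover , inj₁ (shut , _)) =
    let pos , cover′ = to cover-∷ cover
        done , ¬done = from (exact-cover-squares n ρ′) cover′
    in done , subst (λ μ → ¬ rest 0 n μ ≡ []) (sym (peel-tail-shut mon pos shut)) ¬done
  backward (cover , inj₂ (unshut , survives)) =
    let done , ¬done₁ = from (survives-squares n ρ′ p′) (proj₂ (to cover-∷ cover) , survives)
    in done , subst (λ μ → ¬ rest 0 n μ ≡ []) (sym (peel-tail-open mon unshut)) ¬done₁

survives-rect : ∀ m ν → IsPartition ν →
  (rest 1 (suc (suc m)) ν ≡ [] × ¬ rest 0 (suc m) ν ≡ []) ⇔
  (Covers (cs 1 (suc (suc m)) ν) ν × Survives 1 ν (cs 1 (suc (suc m)) ν))
survives-rect m ν p = mk⇔ forward backward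
  where
  ρ₀ = peel rect ν
  p₀ = IsPartition-drop (rect ν) p
  mon = proj₂ p
  cover-∷ = Covers-∷ {rect ν} {cs 0 (suc m) ρ₀} (durfee-≤-length 1 ν)

  pos : rest 0 (suc m) ρ₀ ≡ [] × ¬ rest 0 (suc m) ν ≡ [] → 1 ≤ rect ν
  pos (done , ¬done) = n≢0⇒n>0 λ h≡0 → ¬done (subst (λ k → rest 0 (suc m) (drop k ν) ≡ []) h≡0 done)

  forward : rest 0 (suc m) ρ₀ ≡ [] × ¬ rest 0 (suc m) ν ≡ [] →
            Covers (cs 1 (suc (suc m)) ν) ν × Survives 1 ν (cs 1 (suc (suc m)) ν)
  forward ends@(done , ¬done) with nth ρ₀ 1 <? suc (rect ν)
  ... | yes shut = from cover-∷ (pos ends , to (exact-cover-squares m ρ₀) (done , ¬done₀)) ,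
                   inj₁ (shut , s≤s (pos ends))
    where ¬done₀ = subst (λ μ → ¬ rest 0 m μ ≡ []) (peel-after-rect-shut mon shut) ¬done
  ... | no unshut = from cover-∷ (pos ends , proj₁ survives) , inj₂ (unshut , proj₂ survives)
    where
    survives = to (survives-squares m ρ₀ p₀)
      (done , subst (λ μ → ¬ rest 0 m μ ≡ []) (peel-after-rect-open mon unshut) ¬done)

  backward : Covers (cs 1 (suc (suc m)) ν) ν × Survives 1 ν (cs 1 (suc (suc m)) ν) →
             rest 0 (suc m) ρ₀ ≡ [] × ¬ rest 0 (suc m) ν ≡ []
  backward (cover , inj₁ (shut , _)) =
    let done , ¬done₀ = from (exact-cover-squares m ρ₀) (proj₂ (to cover-∷ cover))
    in done , subst (λ μ → ¬ rest 0 m μ ≡ []) (sym (peel-after-rect-shut mon shut)) ¬done₀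
  backward (cover , inj₂ (unshut , survives)) =
    let done , ¬done₀ = from (survives-squares m ρ₀ p₀) (proj₂ (to cover-∷ cover) , survives)
    in done , subst (λ μ → ¬ rest 0 m μ ≡ []) (sym (peel-after-rect-open mon unshut)) ¬done₀

SurvivesAfter : ℕ → List ℕ → List ℕ → Set
SurvivesAfter zero    ν c       = Survives 1 ν c
SurvivesAfter (suc k) ν []      = ⊥
SurvivesAfter (suc k) ν (x ∷ c) = SurvivesAfter k (drop x ν) c

survives-mixed : ∀ k m λ′ → IsPartition λ′ →
  (rest (suc k) (suc k + suc m) λ′ ≡ [] × ¬ rest k (k + suc m) λ′ ≡ []) ⇔
  (Covers (cs (suc k) (suc k + suc m) λ′) λ′ × SurvivesAfter k λ′ (cs (suc k) (suc k + suc m) λ′))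
survives-mixed zero    m λ′ p = survives-rect m λ′ p
survives-mixed (suc k) m λ′ p = mk⇔
  (λ ends → let cover′ , survives = to ih ends in from cover-∷ (pos ends , cover′) , survives)
  (λ (cover , survives) → from ih (proj₂ (to cover-∷ cover) , survives))
  where
  ih = survives-mixed k m (peel rect λ′) (IsPartition-drop (rect λ′) p)
  cover-∷ = Covers-∷ {rect λ′} {cs (suc k) (suc k + suc m) (peel rect λ′)} (durfee-≤-length 1 λ′)
  -- An empty first rectangle changes nothing, so the statement for k applies to λ′ itself and
  -- yields a covering whose first block is that empty rectangle.
  pos : rest (suc k) (suc k + suc m) (peel rect λ′) ≡ [] × ¬ rest k (k + suc m) (peel rect λ′) ≡ [] →
        1 ≤ rect λ′
  pos ends with rect λ′ in h≡
  ... | suc _ = s≤s z≤n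
  ... | zero with to (survives-mixed k m λ′ p) ends
  ...   | (1≤h ∷ _ , _) , _ = subst (1 ≤_) h≡ 1≤h

NoneUpTo : (ℕ → Set) → ℕ → Set
NoneUpTo S N = ∀ j → 1 ≤ j → j ≤ N → ¬ S j

IsLeast : (ℕ → Set) → ℕ → ℕ → Set
IsLeast S N m = (1 ≤ m × m ≤ N × S m) × (∀ j → 1 ≤ j → j < m → ¬ S j)

-- Alternatives is the disjunction (a) ⊎ (b) ⊎ (c) of part (3); SquareAlternatives is its analogue
-- when every block is a square, where the least element also needs a block of width > 1.
Alternatives : (ℕ → Set) → ℕ → ℕ → (ℕ → ℕ) → Set
Alternatives S N last prev =
  (NoneUpTo S N × 1 < last) ⊎ IsLeast S N 1 ⊎ ∃[ m ] (IsLeast S N m × 2 ≤ m × m ≤ N × 1 < prev m)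

SquareAlternatives : (ℕ → Set) → ℕ → List ℕ → Set
SquareAlternatives S N c = (NoneUpTo S N × 1 < nth c (suc N)) ⊎ ∃[ m ] (IsLeast S N m × 1 < nth c m)

IsLeast-one : ∀ {S N} → IsLeast S (suc N) 1 ⇔ S 1
IsLeast-one = mk⇔ (λ ((_ , _ , S₁) , _) → S₁) (λ S₁ → (≤-refl , s≤s z≤n , S₁) , λ { _ (s≤s z≤n) (s≤s ()) })

module _ {S S′ : ℕ → Set} (shift : ∀ j → S (suc (suc j)) ≡ S′ (suc j)) where

  NoneUpTo-suc : ∀ {N} → NoneUpTo S (suc N) ⇔ (¬ S 1 × NoneUpTo S′ N)
  NoneUpTo-suc = mk⇔
    (λ none → none 1 ≤-refl (s≤s z≤n) ,
       λ { (suc j) _ j≤N → none (suc (suc j)) (s≤s z≤n) (s≤s j≤N) ∘ subst id (sym (shift j)) })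
    (λ (¬S₁ , none′) → λ { (suc zero) _ _ → ¬S₁
                         ; (suc (suc j)) _ (s≤s j≤N) → none′ (suc j) (s≤s z≤n) j≤N ∘ subst id (shift j) })

  IsLeast-suc : ∀ {N m} → IsLeast S (suc N) (suc (suc m)) ⇔ (¬ S 1 × IsLeast S′ N (suc m))
  IsLeast-suc = mk⇔
    (λ { ((_ , s≤s m≤N , Sm) , below) → below 1 ≤-refl (s≤s (s≤s z≤n)) ,
           (s≤s z≤n , m≤N , subst id (shift _) Sm) ,
           λ { (suc j) _ j<m → below (suc (suc j)) (s≤s z≤n) (s≤s j<m) ∘ subst id (sym (shift j)) } })
    (λ (¬S₁ , (_ , m≤N , Sm) , below′) → (s≤s z≤n , s≤s m≤N , subst id (sym (shift _)) Sm) ,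
       λ { (suc zero) _ _ → ¬S₁
         ; (suc (suc j)) _ (s≤s j<m) → below′ (suc j) (s≤s z≤n) j<m ∘ subst id (shift j) })

  SquareAlternatives-∷ : ∀ {N e c} →
    SquareAlternatives S (suc N) (e ∷ c) ⇔ ((S 1 × 1 < e) ⊎ (¬ S 1 × SquareAlternatives S′ N c))
  SquareAlternatives-∷ = mk⇔
    (λ { (inj₁ (none , wide)) → let ¬S₁ , none′ = to NoneUpTo-suc none in inj₂ (¬S₁ , inj₁ (none′ , wide))
       ; (inj₂ (suc zero , least , wide)) → inj₁ (to IsLeast-one least , wide)
       ; (inj₂ (suc (suc m) , least , wide)) →
           let ¬S₁ , least′ = to IsLeast-suc least in inj₂ (¬S₁ , inj₂ (suc m , least′ , wide))
       ; (inj₂ (zero , ((() , _) , _) , _)) })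
    (λ { (inj₁ (S₁ , wide)) → inj₂ (1 , from IsLeast-one S₁ , wide)
       ; (inj₂ (¬S₁ , inj₁ (none′ , wide))) → inj₁ (from NoneUpTo-suc (¬S₁ , none′) , wide)
       ; (inj₂ (¬S₁ , inj₂ (suc m , least′ , wide))) → inj₂ (suc (suc m) , from IsLeast-suc (¬S₁ , least′) , wide)
       ; (inj₂ (_ , inj₂ (zero , ((() , _) , _) , _))) })

  Alternatives-∷ : ∀ {N h c} →
    Alternatives S (suc N) (nth c (suc N)) (nth (h ∷ c)) ⇔ (S 1 ⊎ (¬ S 1 × SquareAlternatives S′ N c))
  Alternatives-∷ = mk⇔
    (λ { (inj₁ (none , wide)) → let ¬S₁ , none′ = to NoneUpTo-suc none in inj₂ (¬S₁ , inj₁ (none′ , wide))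
       ; (inj₂ (inj₁ least)) → inj₁ (to IsLeast-one least)
       ; (inj₂ (inj₂ (suc (suc m) , least , _ , _ , wide))) →
           let ¬S₁ , least′ = to IsLeast-suc least in inj₂ (¬S₁ , inj₂ (suc m , least′ , wide))
       ; (inj₂ (inj₂ (suc zero , _ , s≤s () , _))) })
    (λ { (inj₁ S₁) → inj₂ (inj₁ (from IsLeast-one S₁))
       ; (inj₂ (¬S₁ , inj₁ (none′ , wide))) → inj₁ (from NoneUpTo-suc (¬S₁ , none′) , wide)
       ; (inj₂ (¬S₁ , inj₂ (suc m , least′ , wide))) →
           let least = from IsLeast-suc (¬S₁ , least′)
           in inj₂ (inj₂ (suc (suc m) , least , s≤s (s≤s z≤n) , proj₁ (proj₂ (proj₁ least)) , wide))
       ; (inj₂ (_ , inj₂ (zero , ((() , _) , _) , _))) })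

module _ {S S′ : ℕ → Set} {N : ℕ} (S⇔S′ : ∀ j → 1 ≤ j → j ≤ N → S j ⇔ S′ j) where

  NoneUpTo-map : NoneUpTo S N → NoneUpTo S′ N
  NoneUpTo-map none j 1≤j j≤N = none j 1≤j j≤N ∘ from (S⇔S′ j 1≤j j≤N)

  IsLeast-map : ∀ {m} → IsLeast S N m → IsLeast S′ N m
  IsLeast-map ((1≤m , m≤N , Sm) , below) = (1≤m , m≤N , to (S⇔S′ _ 1≤m m≤N) Sm) ,
    λ j 1≤j j<m → below j 1≤j j<m ∘ from (S⇔S′ j 1≤j (≤-trans (<⇒≤ j<m) m≤N))

  Alternatives-map : ∀ {last last′ prev prev′} → last ≡ last′ → (∀ m → 2 ≤ m → prev m ≡ prev′ m) →
    Alternatives S N last prev → Alternatives S′ N last′ prev′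
  Alternatives-map refl _ (inj₁ (none , wide)) = inj₁ (NoneUpTo-map none , wide)
  Alternatives-map refl _ (inj₂ (inj₁ least)) = inj₂ (inj₁ (IsLeast-map least))
  Alternatives-map refl prev≡ (inj₂ (inj₂ (m , least , 2≤m , m≤N , wide))) =
    inj₂ (inj₂ (m , IsLeast-map least , 2≤m , m≤N , subst (1 <_) (prev≡ m 2≤m) wide))

Alternatives-cong : ∀ {S S′ N last last′ prev prev′} → (∀ j → 1 ≤ j → j ≤ N → S j ⇔ S′ j) → last ≡ last′ →
  (∀ m → 2 ≤ m → prev m ≡ prev′ m) → Alternatives S N last prev ⇔ Alternatives S′ N last′ prev′
Alternatives-cong S⇔S′ last≡ prev≡ = mk⇔
  (Alternatives-map S⇔S′ last≡ prev≡)
  (Alternatives-map (λ j 1≤j j≤N → ⇔.sym (S⇔S′ j 1≤j j≤N)) (sym last≡) (λ m 2≤m → sym (prev≡ m 2≤m)))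

≡⇒⇔ : ∀ {A B : Set} → A ≡ B → A ⇔ B
≡⇒⇔ refl = ⇔.refl

ClosedBelow : ℕ → List ℕ → List ℕ → ℕ → Set
ClosedBelow t ρ []      _             = ⊥
ClosedBelow t ρ (e ∷ c) zero          = ⊥
ClosedBelow t ρ (e ∷ c) (suc zero)    = HeadBelow (t + e) (drop e ρ)
ClosedBelow t ρ (e ∷ c) (suc (suc j)) = ClosedBelow 0 (drop e ρ) c (suc j)

survives-squares-alternatives : ∀ ρ e c →
  Survives 0 ρ (e ∷ c) ⇔ SquareAlternatives (ClosedBelow 0 ρ (e ∷ c)) (length c) (e ∷ c)
survives-squares-alternatives ρ e [] = mk⇔
  (λ wide → inj₁ ((λ { _ (s≤s z≤n) () }) , wide))
  (λ { (inj₁ (_ , wide)) → wide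
     ; (inj₂ (_ , ((1≤m , m≤0 , _) , _) , _)) → contradiction (≤-trans 1≤m m≤0) λ () })
survives-squares-alternatives ρ e (e′ ∷ c) = ⇔.trans
  (⇔.refl ⊎-⇔ (⇔.refl ×-⇔ survives-squares-alternatives (drop e ρ) e′ c))
  (⇔.sym (SquareAlternatives-∷ (λ _ → refl)))

survives-rect-alternatives : ∀ ν h e c → 1 ≤ h →
  Survives 1 ν (h ∷ e ∷ c) ⇔
  Alternatives (ClosedBelow 1 ν (h ∷ e ∷ c)) (suc (length c)) (nth (e ∷ c) (suc (length c))) (nth (h ∷ e ∷ c))
survives-rect-alternatives ν h e c pos = ⇔.trans
  (mk⇔ proj₁ (_, s≤s pos) ⊎-⇔ (⇔.refl ×-⇔ survives-squares-alternatives (drop h ν) e c))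
  (⇔.sym (Alternatives-∷ (λ _ → refl)))

-- The paper's j ∈ S_λ, for blocks c of λ′ of which the first a are rectangles.
InSOf : ℕ → List ℕ → List ℕ → ℕ → Set
InSOf a λ′ c zero          = ⊥
InSOf a λ′ c (suc zero)    = nth λ′ (sum (take (a + 1 ∸ 1) c) + 1) < nth c a + 1
InSOf a λ′ c (suc (suc j)) = nth λ′ (sum (take (a + suc (suc j) ∸ 1) c) + 1) < nth c (a + suc (suc j) ∸ 1)

InS⇔InSOf : ∀ r i λ′ j → InS r i λ′ j ⇔ InSOf (r ∸ i) λ′ (cs (r ∸ i) (r ∸ 1) λ′) j
InS⇔InSOf r i λ′ zero          = ⇔.refl
InS⇔InSOf r i λ′ (suc zero)    = ⇔.refl
InS⇔InSOf r i λ′ (suc (suc j)) = ⇔.refl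

InSOf-∷ : ∀ k λ′ x c j → InSOf (suc (suc k)) λ′ (x ∷ c) j ≡ InSOf (suc k) (drop x λ′) c j
InSOf-∷ k λ′ x c zero          = refl
InSOf-∷ k λ′ x c (suc zero)    = cong (_< nth c (suc k) + 1) (sym (nth-drop x λ′ (sum (take (k + 1) c))))
InSOf-∷ k λ′ x c (suc (suc j)) = cong₂ _<_
  (sym (nth-drop x λ′ (sum (take (k + suc (suc j)) c))))
  (nth-∷ x c (k + suc (suc j)) (≤-trans (s≤s z≤n) (m≤n+m (suc (suc j)) k)))

ClosedBelow-squares : ∀ ρ c j → suc j ≤ length c →
  ClosedBelow 0 ρ c (suc j) ≡ (nth ρ (sum (take (suc j) c) + 1) < nth c (suc j))
ClosedBelow-squares ρ (e ∷ c) zero    _           = cong (_< e) (nth-drop e ρ 0)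
ClosedBelow-squares ρ (e ∷ c) (suc j) (s≤s j<len) =
  trans (ClosedBelow-squares (drop e ρ) c j j<len) (cong (_< nth c (suc j)) (nth-drop e ρ (sum (take (suc j) c))))

InSOf-ClosedBelow : ∀ λ′ h c j → j ≤ length c → InSOf 1 λ′ (h ∷ c) j ≡ ClosedBelow 1 λ′ (h ∷ c) j
InSOf-ClosedBelow λ′ h c zero          _     = refl
InSOf-ClosedBelow λ′ h c (suc zero)    _     = cong₂ _<_ (sym (nth-drop h λ′ 0)) (+-comm h 1)
InSOf-ClosedBelow λ′ h c (suc (suc j)) j≤len = sym (trans
  (ClosedBelow-squares (drop h λ′) c j (<⇒≤ j≤len))
  (cong (_< nth c (suc j)) (nth-drop h λ′ (sum (take (suc j) c)))))

alternatives-survives : ∀ k n λ′ c → length c ≡ suc k + suc n → All (1 ≤_) c →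
  Alternatives (InSOf (suc k) λ′ c) (suc n) (nth c (suc k + suc n)) (λ m → nth c (suc k + m ∸ 1)) ⇔
  SurvivesAfter k λ′ c
alternatives-survives zero n λ′ (h ∷ e ∷ c) len (pos ∷ _) with suc-injective (suc-injective len)
... | refl = ⇔.trans
  (Alternatives-cong (λ j _ j≤n → ≡⇒⇔ (InSOf-ClosedBelow λ′ h (e ∷ c) j j≤n)) refl (λ _ _ → refl))
  (⇔.sym (survives-rect-alternatives λ′ h e c pos))
alternatives-survives (suc k) n λ′ (x ∷ c) len (_ ∷ poss) = ⇔.trans
  (Alternatives-cong (λ j _ _ → ≡⇒⇔ (InSOf-∷ k λ′ x c j)) refl
     (λ m 2≤m → nth-∷ x c (k + m) (≤-trans (s≤s z≤n) (≤-trans 2≤m (m≤n+m m k)))))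
  (alternatives-survives k n (drop x λ′) c (suc-injective len) poss)

difference-mixed-rest : ∀ k n λ′ → IsPartition λ′ → let c = cs (suc k) (suc k + suc n) λ′ in
  (rest (suc k) (suc k + suc n) λ′ ≡ [] × ¬ rest k (k + suc n) λ′ ≡ []) ⇔
  (Covers c λ′ × Alternatives (InSOf (suc k) λ′ c) (suc n) (nth c (suc k + suc n)) (λ m → nth c (suc k + m ∸ 1)))
difference-mixed-rest k n λ′ p = ⇔.trans (survives-mixed k n λ′ p) (mk⇔
  (λ (cover , survives) → cover , from (alternatives cover) survives)
  (λ (cover , alt) → cover , to (alternatives cover) alt))
  where
  c = cs (suc k) (suc k + suc n) λ′
  alternatives : Covers c λ′ →
    Alternatives (InSOf (suc k) λ′ c) (suc n) (nth c (suc k + suc n)) (λ m → nth c (suc k + m ∸ 1)) ⇔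
    SurvivesAfter k λ′ c
  alternatives (positive , _) = alternatives-survives k n λ′ c (length-cs (suc k) (suc k + suc n) λ′) positive

InD≡ : ∀ r i {a b} λ′ → r ∸ (i ⊓ r) ≡ a → r ∸ 1 ≡ b → InD r i λ′ ≡ (rest a b λ′ ≡ [])
InD≡ r i λ′ refl refl = refl

InD-diagonal : ∀ r λ′ → InD r r λ′ ≡ (rest 0 (r ∸ 1) λ′ ≡ [])
InD-diagonal r λ′ = InD≡ r r λ′ (trans (cong (r ∸_) (⊓-idem r)) (n∸n≡0 r)) refl

InD-beyond : ∀ r i λ′ → r ≤ i → InD r i λ′ ≡ InD r r λ′
InD-beyond r i λ′ r≤i = cong (λ j → InD₀ r j λ′) (trans (m≥n⇒m⊓n≡n r≤i) (sym (⊓-idem r)))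

Cond3⇔ : ∀ r i {a b} λ′ → r ∸ i ≡ a → r ∸ 1 ≡ b → let c = cs a b λ′ in
  Cond3 r i λ′ ⇔ (Covers c λ′ × Alternatives (InSOf a λ′ c) (i ∸ 1) (nth c b) (λ m → nth c (a + m ∸ 1)))
Cond3⇔ r i λ′ refl refl = ⇔.refl ×-⇔ Alternatives-cong (λ j _ _ → InS⇔InSOf r i λ′ j) refl (λ _ _ → refl)

difference-mixed : ∀ r i → 2 ≤ i → i ≤ r ∸ 1 → ∀ λ′ → IsPartition λ′ →
  (InD r i λ′ × ¬ InD (r ∸ 1) i λ′) ⇔ Cond3 r i λ′
difference-mixed (suc r) (suc zero) (s≤s ()) _ _ _
difference-mixed (suc r) i@(suc (suc n)) _ i≤r λ′ p with m≤n⇒∃[o]m+o≡n i≤r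
... | k , refl = ⇔.trans
  (≡⇒⇔ (cong₂ (λ A B → A × ¬ B) (InD≡ (suc r) i λ′ r∸[i⊓r] (cong suc i+k≡)) (InD≡ r i λ′ r-1∸[i⊓r-1] i+k≡)))
  (⇔.trans (difference-mixed-rest k n λ′ p) (⇔.sym (Cond3⇔ (suc r) i λ′ r∸i (cong suc i+k≡))))
  where
  i+k≡ : suc n + k ≡ k + suc n
  i+k≡ = +-comm (suc n) k
  r∸i : suc (i + k) ∸ i ≡ suc k
  r∸i = trans (cong (_∸ i) (sym (+-suc i k))) (m+n∸m≡n i (suc k))
  r∸[i⊓r] : suc (i + k) ∸ (i ⊓ suc (i + k)) ≡ suc k
  r∸[i⊓r] = trans (cong (suc (i + k) ∸_) (m≤n⇒m⊓n≡m (m≤n⇒m≤1+n (m≤m+n i k)))) r∸i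
  r-1∸[i⊓r-1] : (i + k) ∸ (i ⊓ (i + k)) ≡ k
  r-1∸[i⊓r-1] = trans (cong ((i + k) ∸_) (m≤n⇒m⊓n≡m (m≤m+n i k))) (m+n∸m≡n i k)

lemma4p4 : (r : ℕ) → 2 ≤ r →
    ((λ' : List ℕ) → IsPartition λ' →
       ((InD r 1 λ' × ¬ InD (r ∸ 1) 1 λ') ⇔ Covers (cs (r ∸ 1) (r ∸ 1) λ') λ'))
    ×
    ((λ' : List ℕ) → IsPartition λ' →
       ((InD r r λ' × ¬ InD (r ∸ 1) r λ') ⇔ (InD r r λ' × ¬ InD (r ∸ 1) (r ∸ 1) λ'))
       × ((InD r r λ' × ¬ InD (r ∸ 1) (r ∸ 1) λ') ⇔ Covers (cs 0 (r ∸ 1) λ') λ'))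
    ×
    ((i : ℕ) → 2 ≤ i → i ≤ r ∸ 1 → (λ' : List ℕ) → IsPartition λ' →
       ((InD r i λ' × ¬ InD (r ∸ 1) i λ') ⇔ Cond3 r i λ'))
lemma4p4 (suc zero) (s≤s ())
lemma4p4 r@(suc (suc r-2)) _ =
  (λ λ′ _ → exact-cover-rects r-2 λ′) ,
  (λ λ′ _ → ≡⇒⇔ (cong (λ D → InD r r λ′ × ¬ D) (InD-beyond (suc r-2) r λ′ (n≤1+n _))) ,
            ⇔.trans (≡⇒⇔ (cong₂ (λ A B → A × ¬ B) (InD-diagonal r λ′) (InD-diagonal (suc r-2) λ′)))
                    (exact-cover-squares r-2 λ′)) ,
  difference-mixed r
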